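{- Let $k$ be a positive integer and $n=2k$. Then $rn(C_n\square C_n)\le \frac{n^2-2}{2}(k+2)+2$.
   Context: $C_n$ is the cycle graph with vertex set $\{0,\dots,n-1\}$, distinct $v,w$ adjacent iff $v\equiv w\pm1 \pmod n$. The Cartesian product $G\square H$ has vertex set $V(G)\times V(H)$, with $(g,h)\sim(g',h')$ iff ($g=g'$ and $hh'\in E(H)$) or ($h=h'$ and $gg'\in E(G)$). $d(u,v)$ is graph distance and $\operatorname{diam}(G)$ the maximum distance in $G$. A radio labeling of a connected graph $G$ is a function $c:V(G)\to\{1,2,\dots\}$ with $d(u,v)+|c(u)-c(v)|\ge 1+\operatorname{diam}(G)$ for all distinct $u,v$. The span of $c$ is its maximum value; $rn(G)$ is the minimum span over all radio labelings of $G$. -}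

module Defs where

open import Data.Nat using (ℕ; zero; suc; _+_; _*_; _∸_; _≤_; ∣_-_∣)
open import Data.Fin using (Fin; toℕ)
open import Data.Product using (_×_; _,_; ∃; ∃-syntax)
open import Data.Sum using (_⊎_)
open import Relation.Binary.PropositionalEquality using (_≡_; _≢_)

data Walk {V : Set} (adj : V → V → Set) : V → V → ℕ → Set where
  here : ∀ {u} → Walk adj u u zero
  step : ∀ {u w v m} → adj u w → Walk adj w v m → Walk adj u v (suc m)

Dist : {V : Set} → (V → V → Set) → V → V → ℕ → Set
Dist adj u v d = Walk adj u v d × (∀ m → Walk adj u v m → d ≤ m)

Diam : {V : Set} → (V → V → Set) → ℕ → Set
Diam {V} adj D =
  (∀ u v d → Dist adj u v d → d ≤ D) × (∃[ u ] ∃[ v ] Dist adj u v D)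

Connected : {V : Set} → (V → V → Set) → Set
Connected {V} adj = ∀ (u v : V) → ∃[ m ] Walk adj u v m

IsRadioLabeling : {V : Set} → (V → V → Set) → (V → ℕ) → Set
IsRadioLabeling {V} adj c =
  (∀ v → 1 ≤ c v) ×
  (∀ D → Diam adj D → ∀ (u v : V) → u ≢ v → ∀ d → Dist adj u v d →
     suc D ≤ d + ∣ c u - c v ∣)

-- Span of c is at most B (the span is the maximum label).
SpanAtMost : {V : Set} → (V → ℕ) → ℕ → Set
SpanAtMost {V} c B = ∀ (v : V) → c v ≤ B

rn≤ : {V : Set} → (V → V → Set) → ℕ → Set
rn≤ {V} adj B = ∃[ c ] (IsRadioLabeling adj c × SpanAtMost c B)

CycleAdj : (n : ℕ) → Fin n → Fin n → Set
CycleAdj n v w = v ≢ w ×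
  ( (suc (toℕ v) ≡ toℕ w)
  ⊎ (suc (toℕ w) ≡ toℕ v)
  ⊎ (suc (toℕ v) ≡ n × toℕ w ≡ 0)
  ⊎ (suc (toℕ w) ≡ n × toℕ v ≡ 0))

BoxAdj : {A B : Set} → (A → A → Set) → (B → B → Set) → A × B → A × B → Set
BoxAdj adjG adjH (g , h) (g' , h') =
  (g ≡ g' × adjH h h') ⊎ (h ≡ h' × adjG g g')

TorusAdj : (n : ℕ) → Fin n × Fin n → Fin n × Fin n → Set
TorusAdj n = BoxAdj (CycleAdj n) (CycleAdj n)

-- Write n = 2k and pair every vertex u of C_n □ C_n with its antipode u + (k, k). The graph
-- distance is the sum of the two cyclic distances, hence the diameter is n and the antipode of u
-- is at distance n − d(u, v) from v. The pairs are listed through the base vertices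
-- (x, (x + t)k + r), x, r < k, t < 2, in the order of their rank nx + 2r + t; the base vertex of
-- rank j gets label 1 + (k + 2)j and its antipode 2 + (k + 2)j. Consecutive base vertices are at
-- distance k − 1 or k, so consecutive pairs (label gaps k + 1, k + 2 or k + 3) satisfy the radio
-- condition, a vertex and its antipode are at distance n with label gap 1, and labels of ranks
-- two or more apart differ by more than n. The largest rank is n²/2 − 1, which gives the bound.

module Submission where

open import Data.Empty using (⊥-elim)
open import Data.Fin using (Fin; toℕ; zero; suc)
open import Data.Fin.Properties using (toℕ-fromℕ<; toℕ-injective; toℕ<n)
open import Data.Nat using (ℕ; zero; suc; _+_; _*_; _∸_; _≤_; _<_; _⊓_; s≤s; z≤n; z<s; NonZero; >-nonZero; ∣_-_∣; _≤?_; _<?_)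
open import Data.Nat.DivMod using (_%_; _/_; _mod_; [m+kn]%n≡m%n; m<n⇒m%n≡m; m≡m%n+[m/n]*n; m%n<n; n%n≡0; m*n/n≡m)
open import Data.Nat.Properties
open import Algebra.Properties.CommutativeSemigroup +-commutativeSemigroup using () renaming (interchange to +-interchange)
open import Data.Nat.Tactic.RingSolver using (solve-∀)
open import Data.Product using (_×_; _,_; proj₁; proj₂; ∃; ∃₂)
open import Data.Sum using (_⊎_; inj₁; inj₂)
open import Function using (_∘_)
open import Relation.Binary.PropositionalEquality
open import Relation.Nullary using (yes; no)

open import Defs

module _ {V : Set} {adj : V → V → Set} where

  _◅◅_ : ∀ {u v w m l} → Walk adj u v m → Walk adj v w l → Walk adj u w (m + l)
  here     ◅◅ q = q
  step e p ◅◅ q = step e (p ◅◅ q)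

  reverse : (∀ {u v} → adj u v → adj v u) → ∀ {u v m} → Walk adj u v m → Walk adj v u m
  reverse sym here               = here
  reverse sym (step {m = m} e p) = subst (Walk adj _ _) (+-comm m 1) (reverse sym p ◅◅ step (sym e) here)

  Lipschitz : (V → ℕ) → Set
  Lipschitz φ = ∀ {u w} → adj u w → φ u ≤ suc (φ w)

  Lipschitz⇒≤-length : ∀ {φ} → Lipschitz φ → ∀ {u v m} → Walk adj u v m → φ u ≤ m + φ v
  Lipschitz⇒≤-length lip here       = ≤-refl
  Lipschitz⇒≤-length lip (step e p) = ≤-trans (lip e) (s≤s (Lipschitz⇒≤-length lip p))

  Diam≤ : ∀ {B D} (δ : V → V → ℕ) → (∀ u v → Walk adj u v (δ u v)) → (∀ u v → δ u v ≤ B) →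
          Diam adj D → D ≤ B
  Diam≤ δ walk δ≤B (_ , u , v , _ , minimal) = ≤-trans (minimal _ (walk u v)) (δ≤B u v)

module _ {A B : Set} {adjA : A → A → Set} {adjB : B → B → Set} where

  liftˡ : ∀ {a a' m} (b : B) → Walk adjA a a' m → Walk (BoxAdj adjA adjB) (a , b) (a' , b) m
  liftˡ b here       = here
  liftˡ b (step e p) = step (inj₂ (refl , e)) (liftˡ b p)

  liftʳ : ∀ {b b' m} (a : A) → Walk adjB b b' m → Walk (BoxAdj adjA adjB) (a , b) (a , b') m
  liftʳ a here       = here
  liftʳ a (step e p) = step (inj₁ (refl , e)) (liftʳ a p)

  BoxAdj-sym : (∀ {a a'} → adjA a a' → adjA a' a) → (∀ {b b'} → adjB b b' → adjB b' b) →
               ∀ {u v} → BoxAdj adjA adjB u v → BoxAdj adjA adjB v u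
  BoxAdj-sym symA symB (inj₁ (eq , e)) = inj₁ (sym eq , symB e)
  BoxAdj-sym symA symB (inj₂ (eq , e)) = inj₂ (sym eq , symA e)

  Lipschitz-box : ∀ {φ ψ} → Lipschitz {adj = adjA} φ → Lipschitz {adj = adjB} ψ →
                  Lipschitz {adj = BoxAdj adjA adjB} (λ u → φ (proj₁ u) + ψ (proj₂ u))
  Lipschitz-box {φ} lipA lipB (inj₁ (refl , e)) = ≤-trans (+-monoʳ-≤ (φ _) (lipB e)) (≤-reflexive (+-suc _ _))
  Lipschitz-box     lipA lipB (inj₂ (refl , e)) = +-monoˡ-≤ _ (lipA e)

divMod-injective : ∀ {d c c'} a a' → c < d → c' < d → c + a * d ≡ c' + a' * d → c ≡ c' × a ≡ a'
divMod-injective {d} {c} {c'} a a' c<d c'<d eq =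
  c≡c' , *-cancelʳ-≡ a a' d (+-cancelˡ-≡ c _ _ (trans eq (cong (_+ a' * d) (sym c≡c'))))
  where
  instance
    d≢0 : NonZero d
    d≢0 = >-nonZero (≤-<-trans z≤n c<d)
  c≡c' : c ≡ c'
  c≡c' = begin
    c               ≡⟨ m<n⇒m%n≡m c<d ⟨
    c % d           ≡⟨ [m+kn]%n≡m%n c a d ⟨
    (c + a * d) % d ≡⟨ cong (_% d) eq ⟩
    (c' + a' * d) % d ≡⟨ [m+kn]%n≡m%n c' a' d ⟩
    c' % d          ≡⟨ m<n⇒m%n≡m c'<d ⟩
    c'              ∎
    where open ≡-Reasoning

module CycleDistance (n : ℕ) (1<n : 1 < n) where

  private instance
    n≢0 : NonZero n
    n≢0 = >-nonZero (<-trans z<s 1<n)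

  md : ℕ → Fin n
  md a = a mod n

  toℕ-md : ∀ a → toℕ (md a) ≡ a % n
  toℕ-md a = toℕ-fromℕ< _

  md-toℕ : ∀ a → md (toℕ a) ≡ a
  md-toℕ a = toℕ-injective (trans (toℕ-md (toℕ a)) (m<n⇒m%n≡m (toℕ<n a)))

  md-cong : ∀ {a b} i j → a + i * n ≡ b + j * n → md a ≡ md b
  md-cong {a} {b} i j eq = toℕ-injective (begin
    toℕ (md a)     ≡⟨ toℕ-md a ⟩
    a % n          ≡⟨ [m+kn]%n≡m%n a i n ⟨
    (a + i * n) % n ≡⟨ cong (_% n) eq ⟩
    (b + j * n) % n ≡⟨ [m+kn]%n≡m%n b j n ⟩
    b % n          ≡⟨ toℕ-md b ⟨
    toℕ (md b)     ∎)
    where open ≡-Reasoning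

  md-toℕ-md : ∀ a b → md (toℕ (md a) + b) ≡ md (a + b)
  md-toℕ-md a b = md-cong (a / n) 0 (begin
    toℕ (md a) + b + a / n * n ≡⟨ cong (λ z → z + b + a / n * n) (toℕ-md a) ⟩
    a % n + b + a / n * n      ≡⟨ shuffle (a % n) b (a / n * n) ⟩
    a % n + a / n * n + b + 0  ≡⟨ cong (λ z → z + b + 0) (m≡m%n+[m/n]*n a n) ⟨
    a + b + 0 * n              ∎)
    where
    open ≡-Reasoning
    shuffle : ∀ x y z → x + y + z ≡ x + z + y + 0
    shuffle = solve-∀

  md-toℕ-mdʳ : ∀ a b → md (a + toℕ (md b)) ≡ md (a + b)
  md-toℕ-mdʳ a b = trans (cong md (+-comm a _)) (trans (md-toℕ-md b a) (cong md (+-comm b a)))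

  offset : Fin n → Fin n → ℕ
  offset a b = toℕ (md (toℕ a + (n ∸ toℕ b)))

  offset<n : ∀ a b → offset a b < n
  offset<n a b = toℕ<n _

  offset-spec : ∀ a b → md (toℕ b + offset a b) ≡ a
  offset-spec a b = begin
    md (toℕ b + offset a b)               ≡⟨ cong md (+-comm (toℕ b) _) ⟩
    md (offset a b + toℕ b)               ≡⟨ md-toℕ-md _ (toℕ b) ⟩
    md (toℕ a + (n ∸ toℕ b) + toℕ b)      ≡⟨ md-cong 0 1 eq ⟩
    md (toℕ a)                            ≡⟨ md-toℕ a ⟩
    a                                     ∎
    where
    open ≡-Reasoning
    eq : toℕ a + (n ∸ toℕ b) + toℕ b + 0 * n ≡ toℕ a + 1 * n
    eq = begin
      toℕ a + (n ∸ toℕ b) + toℕ b + 0 ≡⟨ +-identityʳ _ ⟩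
      toℕ a + (n ∸ toℕ b) + toℕ b     ≡⟨ +-assoc (toℕ a) _ _ ⟩
      toℕ a + ((n ∸ toℕ b) + toℕ b)   ≡⟨ cong (toℕ a +_) (m∸n+n≡m (<⇒≤ (toℕ<n b))) ⟩
      toℕ a + n                       ≡⟨ cong (toℕ a +_) (+-identityʳ n) ⟨
      toℕ a + 1 * n                   ∎

  offset-unique : ∀ {a b s} → s < n → md (toℕ b + s) ≡ a → offset a b ≡ s
  offset-unique {a} {b} {s} s<n refl = begin
    toℕ (md (toℕ (md (toℕ b + s)) + (n ∸ toℕ b))) ≡⟨ cong toℕ (md-toℕ-md _ _) ⟩
    toℕ (md (toℕ b + s + (n ∸ toℕ b)))           ≡⟨ cong toℕ (md-cong 0 1 eq) ⟩
    toℕ (md s)                                   ≡⟨ toℕ-md s ⟩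
    s % n                                        ≡⟨ m<n⇒m%n≡m s<n ⟩
    s                                            ∎
    where
    open ≡-Reasoning
    eq : toℕ b + s + (n ∸ toℕ b) + 0 * n ≡ s + 1 * n
    eq = begin
      toℕ b + s + (n ∸ toℕ b) + 0   ≡⟨ +-identityʳ _ ⟩
      toℕ b + s + (n ∸ toℕ b)       ≡⟨ cong (_+ (n ∸ toℕ b)) (+-comm (toℕ b) s) ⟩
      s + toℕ b + (n ∸ toℕ b)       ≡⟨ +-assoc s _ _ ⟩
      s + (toℕ b + (n ∸ toℕ b))     ≡⟨ cong (s +_) (m+[n∸m]≡n (<⇒≤ (toℕ<n b))) ⟩
      s + n                         ≡⟨ cong (s +_) (+-identityʳ n) ⟨
      s + 1 * n                     ∎

  minArc : ℕ → ℕ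
  minArc s = s ⊓ (n ∸ s)

  cycDist : Fin n → Fin n → ℕ
  cycDist a b = minArc (offset a b)

  cycDist-unique : ∀ a b {s} → s < n → md (toℕ b + s) ≡ a → cycDist a b ≡ minArc s
  cycDist-unique a b s<n eq = cong minArc (offset-unique s<n eq)

  cycDist-md : ∀ {a b s} j → s < n → b + s ≡ a + j * n → cycDist (md a) (md b) ≡ minArc s
  cycDist-md {a} {b} {s} j s<n eq = cycDist-unique (md a) (md b) s<n (begin
    md (toℕ (md b) + s) ≡⟨ md-toℕ-md b s ⟩
    md (b + s)          ≡⟨ md-cong 0 j (trans (+-identityʳ _) eq) ⟩
    md a                ∎)
    where open ≡-Reasoning

  cycDist-refl : ∀ a → cycDist a a ≡ 0
  cycDist-refl a = cycDist-unique a a (<-trans z<s 1<n) (trans (cong md (+-identityʳ _)) (md-toℕ a))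

  minArc-suc : ∀ {s} → s < n → minArc s ≤ suc (minArc (suc s % n)) × minArc (suc s % n) ≤ suc (minArc s)
  minArc-suc {s} s<n with m≤n⇒m<n∨m≡n s<n
  ... | inj₁ 1+s<n rewrite m<n⇒m%n≡m 1+s<n =
    ≤-trans (⊓-mono-≤ (≤-trans (n≤1+n s) (n≤1+n (suc s))) (≤-reflexive (+-∸-assoc 1 s<n))) ≤-refl ,
    ≤-trans (⊓-mono-≤ (≤-refl {suc s}) (≤-trans (∸-monoʳ-≤ n (n≤1+n s)) (n≤1+n (n ∸ s)))) ≤-refl
  ... | inj₂ 1+s≡n rewrite trans (cong (_% n) 1+s≡n) (n%n≡0 n) =
    ≤-trans (m⊓n≤n s (n ∸ s)) (≤-reflexive (trans (cong (_∸ s) (sym 1+s≡n)) (m+n∸n≡m 1 s))) , z≤n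

  next : Fin n → Fin n
  next a = md (suc (toℕ a))

  next-wraps : ∀ {a b : Fin n} → suc (toℕ a) ≡ n → toℕ b ≡ 0 → next a ≡ b
  next-wraps {a} {b} 1+a≡n b≡0 = begin
    md (suc (toℕ a)) ≡⟨ md-cong 0 1 (trans (+-identityʳ _) (trans 1+a≡n (sym (+-identityʳ n)))) ⟩
    md 0             ≡⟨ cong md b≡0 ⟨
    md (toℕ b)       ≡⟨ md-toℕ b ⟩
    b                ∎
    where open ≡-Reasoning

  CycleAdj⇒next : ∀ {a b} → CycleAdj n a b → b ≡ next a ⊎ a ≡ next b
  CycleAdj⇒next {a} {b} (_ , inj₁ e)                   = inj₁ (trans (sym (md-toℕ b)) (cong md (sym e)))
  CycleAdj⇒next {a} {b} (_ , inj₂ (inj₁ e))            = inj₂ (trans (sym (md-toℕ a)) (cong md (sym e)))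
  CycleAdj⇒next (_ , inj₂ (inj₂ (inj₁ (e , z))))       = inj₁ (sym (next-wraps e z))
  CycleAdj⇒next (_ , inj₂ (inj₂ (inj₂ (e , z))))       = inj₂ (sym (next-wraps e z))

  offset-next : ∀ a c → offset (next a) c ≡ suc (offset a c) % n
  offset-next a c = offset-unique (m%n<n _ n) (begin
    md (toℕ c + suc o % n)          ≡⟨ cong md (+-comm (toℕ c) _) ⟩
    md (suc o % n + toℕ c)          ≡⟨ cong (λ z → md (z + toℕ c)) (toℕ-md (suc o)) ⟨
    md (toℕ (md (suc o)) + toℕ c)   ≡⟨ md-toℕ-md (suc o) (toℕ c) ⟩
    md (suc o + toℕ c)              ≡⟨ cong md (rearrange o (toℕ c)) ⟩
    md (toℕ c + o + 1)              ≡⟨ md-toℕ-md (toℕ c + o) 1 ⟨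
    md (toℕ (md (toℕ c + o)) + 1)   ≡⟨ cong (λ z → md (toℕ z + 1)) (offset-spec a c) ⟩
    md (toℕ a + 1)                  ≡⟨ cong md (+-comm (toℕ a) 1) ⟩
    next a                          ∎)
    where
    open ≡-Reasoning
    o = offset a c
    rearrange : ∀ x y → suc x + y ≡ y + x + 1
    rearrange = solve-∀

  cycDist-Lipschitz : ∀ c → Lipschitz {adj = CycleAdj n} (λ a → cycDist a c)
  cycDist-Lipschitz c {a} {b} e with CycleAdj⇒next e
  ... | inj₁ refl = subst (λ z → cycDist a c ≤ suc (minArc z)) (sym (offset-next a c))
                      (proj₁ (minArc-suc (offset<n a c)))
  ... | inj₂ refl = subst (λ z → minArc z ≤ suc (cycDist b c)) (sym (offset-next b c))
                      (proj₂ (minArc-suc (offset<n b c)))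

  CycleAdj-sym : ∀ {a b} → CycleAdj n a b → CycleAdj n b a
  CycleAdj-sym (a≢b , inj₁ e)                   = a≢b ∘ sym , inj₂ (inj₁ e)
  CycleAdj-sym (a≢b , inj₂ (inj₁ e))            = a≢b ∘ sym , inj₁ e
  CycleAdj-sym (a≢b , inj₂ (inj₂ (inj₁ e)))     = a≢b ∘ sym , inj₂ (inj₂ (inj₂ e))
  CycleAdj-sym (a≢b , inj₂ (inj₂ (inj₂ e)))     = a≢b ∘ sym , inj₂ (inj₂ (inj₁ e))

  next-adjacent : ∀ a → CycleAdj n a (next a)
  next-adjacent a with m≤n⇒m<n∨m≡n (toℕ<n a)
  ... | inj₁ 1+a<n = (λ eq → 1+n≢n (sym (trans (cong toℕ eq) toℕ-next))) , inj₁ (sym toℕ-next)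
    where
    toℕ-next : toℕ (next a) ≡ suc (toℕ a)
    toℕ-next = trans (toℕ-md _) (m<n⇒m%n≡m 1+a<n)
  ... | inj₂ 1+a≡n = (λ eq → <-irrefl (trans (sym (cong suc (trans (cong toℕ eq) toℕ-next))) 1+a≡n) 1<n) ,
                     inj₂ (inj₂ (inj₁ (1+a≡n , toℕ-next)))
    where
    toℕ-next : toℕ (next a) ≡ 0
    toℕ-next = trans (toℕ-md _) (trans (cong (_% n) 1+a≡n) (n%n≡0 n))

  forward : ∀ a j → Walk (CycleAdj n) a (md (toℕ a + j)) j
  forward a zero    = subst (λ z → Walk (CycleAdj n) a z 0) (sym (trans (cong md (+-identityʳ _)) (md-toℕ a))) here
  forward a (suc j) = step (next-adjacent a) (subst (λ z → Walk (CycleAdj n) (next a) z j) eq (forward (next a) j))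
    where
    eq : md (toℕ (next a) + j) ≡ md (toℕ a + suc j)
    eq = trans (md-toℕ-md (suc (toℕ a)) j) (cong md (sym (+-suc (toℕ a) j)))

  cycle-walk : ∀ a b → Walk (CycleAdj n) a b (cycDist a b)
  cycle-walk a b with offset a b ≤? n ∸ offset a b
  ... | yes s≤n∸s = subst (Walk (CycleAdj n) a b) (sym (m≤n⇒m⊓n≡m s≤n∸s))
                      (reverse CycleAdj-sym (subst (λ z → Walk (CycleAdj n) b z s) (offset-spec a b) (forward b s)))
    where s = offset a b
  ... | no s≰n∸s = subst (Walk (CycleAdj n) a b) (sym (m≥n⇒m⊓n≡n (<⇒≤ (≰⇒> s≰n∸s))))
                      (subst (λ z → Walk (CycleAdj n) a z (n ∸ s)) ends (forward a (n ∸ s)))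
    where
    s = offset a b
    ends : md (toℕ a + (n ∸ s)) ≡ b
    ends = begin
      md (toℕ a + (n ∸ s))                  ≡⟨ cong (λ z → md (toℕ z + (n ∸ s))) (offset-spec a b) ⟨
      md (toℕ (md (toℕ b + s)) + (n ∸ s))   ≡⟨ md-toℕ-md (toℕ b + s) (n ∸ s) ⟩
      md (toℕ b + s + (n ∸ s))              ≡⟨ md-cong 0 1 eq ⟩
      md (toℕ b)                            ≡⟨ md-toℕ b ⟩
      b                                     ∎
      where
      open ≡-Reasoning
      eq : toℕ b + s + (n ∸ s) + 0 * n ≡ toℕ b + 1 * n
      eq = begin
        toℕ b + s + (n ∸ s) + 0   ≡⟨ +-identityʳ _ ⟩
        toℕ b + s + (n ∸ s)       ≡⟨ +-assoc (toℕ b) s _ ⟩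
        toℕ b + (s + (n ∸ s))     ≡⟨ cong (toℕ b +_) (m+[n∸m]≡n (<⇒≤ (offset<n a b))) ⟩
        toℕ b + n                 ≡⟨ cong (toℕ b +_) (+-identityʳ n) ⟨
        toℕ b + 1 * n             ∎

  torusDist : Fin n × Fin n → Fin n × Fin n → ℕ
  torusDist u v = cycDist (proj₁ u) (proj₁ v) + cycDist (proj₂ u) (proj₂ v)

  TorusAdj-sym : ∀ {u v} → TorusAdj n u v → TorusAdj n v u
  TorusAdj-sym = BoxAdj-sym CycleAdj-sym CycleAdj-sym

  torusDist-refl : ∀ u → torusDist u u ≡ 0
  torusDist-refl u = cong₂ _+_ (cycDist-refl (proj₁ u)) (cycDist-refl (proj₂ u))

  torusDist-≤-length : ∀ {u v m} → Walk (TorusAdj n) u v m → torusDist u v ≤ m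
  torusDist-≤-length {u} {v} {m} w = subst (torusDist u v ≤_) (trans (cong (m +_) (torusDist-refl v)) (+-identityʳ m))
    (Lipschitz⇒≤-length {φ = λ w → torusDist w v} lipschitz w)
    where
    lipschitz = Lipschitz-box (cycDist-Lipschitz (proj₁ v)) (cycDist-Lipschitz (proj₂ v))

  torus-walk : ∀ u v → Walk (TorusAdj n) u v (torusDist u v)
  torus-walk (a , b) (a' , b') = liftˡ b (cycle-walk a a') ◅◅ liftʳ a' (cycle-walk b b')

module EvenTorus (k' : ℕ) where

  k : ℕ
  k = suc k'

  n : ℕ
  n = 2 * k

  k<n : k < n
  k<n = m<m+n k z<s

  1<n : 1 < n
  1<n = ≤-trans (s≤s (s≤s z≤n)) k<n

  open CycleDistance n 1<n

  n≡k+k : n ≡ k + k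
  n≡k+k = cong (k +_) (+-identityʳ k)

  n∸[j+k]≡k∸j : ∀ j → n ∸ (j + k) ≡ k ∸ j
  n∸[j+k]≡k∸j j = trans (cong₂ _∸_ n≡k+k (+-comm j k)) ([m+n]∸[m+o]≡n∸o k k j)

  minArc-≤k : ∀ {s} → s ≤ k → minArc s ≡ s
  minArc-≤k {s} s≤k = m≤n⇒m⊓n≡m (m+n≤o⇒m≤o∸n s (subst (s + s ≤_) (sym n≡k+k) (+-mono-≤ s≤k s≤k)))

  minArc-+k : ∀ {j} → j ≤ k → minArc (j + k) ≡ k ∸ j
  minArc-+k {j} j≤k = trans (m≥n⇒m⊓n≡n far) (n∸[j+k]≡k∸j j)
    where
    far : n ∸ (j + k) ≤ j + k
    far = ≤-trans (≤-reflexive (n∸[j+k]≡k∸j j)) (≤-trans (m∸n≤m k j) (m≤n+m k j))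

  minArc≤k : ∀ s → minArc s ≤ k
  minArc≤k s with s ≤? k
  ... | yes s≤k = ≤-trans (m⊓n≤m s (n ∸ s)) s≤k
  ... | no  s≰k = ≤-trans (m⊓n≤n s (n ∸ s))
                    (≤-trans (∸-monoʳ-≤ n (<⇒≤ (≰⇒> s≰k))) (≤-reflexive (n∸[j+k]≡k∸j 0)))

  ∸k<k : ∀ {s} → s < n → s ∸ k < k
  ∸k<k {s} s<n = m<n+o⇒m∸n<o s k (subst (s <_) n≡k+k s<n)

  toℕ-md-+k : ∀ {s} → k ≤ s → s < n → toℕ (md (s + k)) ≡ s ∸ k
  toℕ-md-+k {s} k≤s s<n = begin
    toℕ (md (s + k))  ≡⟨ cong toℕ (md-cong 0 1 eq) ⟩
    toℕ (md (s ∸ k))  ≡⟨ toℕ-md (s ∸ k) ⟩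
    (s ∸ k) % n       ≡⟨ m<n⇒m%n≡m (<-≤-trans (∸k<k s<n) (m≤m+n k (k + 0))) ⟩
    s ∸ k             ∎
    where
    open ≡-Reasoning
    eq : s + k + 0 * n ≡ s ∸ k + 1 * n
    eq = begin
      s + k + 0           ≡⟨ +-identityʳ _ ⟩
      s + k               ≡⟨ cong (_+ k) (m∸n+n≡m k≤s) ⟨
      s ∸ k + k + k       ≡⟨ +-assoc (s ∸ k) k k ⟩
      s ∸ k + (k + k)     ≡⟨ cong (s ∸ k +_) n≡k+k ⟨
      s ∸ k + n           ≡⟨ cong (s ∸ k +_) (+-identityʳ n) ⟨
      s ∸ k + 1 * n       ∎

  minArc-antipode : ∀ {s} → s < n → minArc (toℕ (md (s + k))) + minArc s ≡ k
  minArc-antipode {s} s<n with s <? k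
  ... | yes s<k = begin
    minArc (toℕ (md (s + k))) + minArc s ≡⟨ cong₂ (λ x y → minArc x + y)
                                              (trans (toℕ-md (s + k)) (m<n⇒m%n≡m s+k<n)) (minArc-≤k (<⇒≤ s<k)) ⟩
    minArc (s + k) + s                   ≡⟨ cong (_+ s) (minArc-+k (<⇒≤ s<k)) ⟩
    (k ∸ s) + s                          ≡⟨ m∸n+n≡m (<⇒≤ s<k) ⟩
    k                                    ∎
    where
    open ≡-Reasoning
    s+k<n : s + k < n
    s+k<n = subst (s + k <_) (sym n≡k+k) (+-monoˡ-< k s<k)
  ... | no s≮k = begin
    minArc (toℕ (md (s + k))) + minArc s ≡⟨ cong₂ (λ x y → minArc x + minArc y)
                                              (toℕ-md-+k k≤s s<n) (sym (m∸n+n≡m k≤s)) ⟩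
    minArc j + minArc (j + k)            ≡⟨ cong₂ _+_ (minArc-≤k (<⇒≤ j<k)) (minArc-+k (<⇒≤ j<k)) ⟩
    j + (k ∸ j)                          ≡⟨ m+[n∸m]≡n (<⇒≤ j<k) ⟩
    k                                    ∎
    where
    open ≡-Reasoning
    k≤s = ≮⇒≥ s≮k
    j = s ∸ k
    j<k = ∸k<k s<n

  antipode : Fin n → Fin n
  antipode a = md (toℕ a + k)

  offset-spec-+ : ∀ a b t → md (toℕ b + offset a b + t) ≡ md (toℕ a + t)
  offset-spec-+ a b t =
    trans (sym (md-toℕ-md (toℕ b + offset a b) t)) (cong (λ z → md (toℕ z + t)) (offset-spec a b))

  cycDist-antipode : ∀ a b → cycDist (antipode a) (antipode b) ≡ cycDist a b
  cycDist-antipode a b = cycDist-unique (antipode a) (antipode b) (offset<n a b) (begin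
    md (toℕ (md (toℕ b + k)) + s) ≡⟨ md-toℕ-md (toℕ b + k) s ⟩
    md (toℕ b + k + s)            ≡⟨ cong md (rearrange (toℕ b) k s) ⟩
    md (toℕ b + s + k)            ≡⟨ offset-spec-+ a b k ⟩
    antipode a                    ∎)
    where
    open ≡-Reasoning
    s = offset a b
    rearrange : ∀ x y z → x + y + z ≡ x + z + y
    rearrange = solve-∀

  cycDist-antipodeˡ : ∀ a b → cycDist (antipode a) b + cycDist a b ≡ k
  cycDist-antipodeˡ a b = trans (cong (_+ cycDist a b) (cycDist-unique (antipode a) b (toℕ<n (md (s + k))) (begin
    md (toℕ b + toℕ (md (s + k))) ≡⟨ md-toℕ-mdʳ (toℕ b) (s + k) ⟩
    md (toℕ b + (s + k))          ≡⟨ cong md (+-assoc (toℕ b) s k) ⟨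
    md (toℕ b + s + k)            ≡⟨ offset-spec-+ a b k ⟩
    antipode a                    ∎)))
    (minArc-antipode (offset<n a b))
    where
    open ≡-Reasoning
    s = offset a b

  cycDist-antipodeʳ : ∀ a b → cycDist a (antipode b) + cycDist a b ≡ k
  cycDist-antipodeʳ a b = trans (cong (_+ cycDist a b) (cycDist-unique a (antipode b) (toℕ<n (md (s + k))) (begin
    md (toℕ (md (toℕ b + k)) + toℕ (md (s + k))) ≡⟨ md-toℕ-md (toℕ b + k) _ ⟩
    md (toℕ b + k + toℕ (md (s + k)))            ≡⟨ md-toℕ-mdʳ (toℕ b + k) (s + k) ⟩
    md (toℕ b + k + (s + k))                     ≡⟨ md-cong 0 1 (rearrange (toℕ b) s k') ⟩
    md (toℕ b + s)                               ≡⟨ offset-spec a b ⟩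
    a                                            ∎)))
    (minArc-antipode (offset<n a b))
    where
    open ≡-Reasoning
    s = offset a b
    rearrange : ∀ x y j → x + suc j + (y + suc j) + 0 * (2 * suc j) ≡ x + y + 1 * (2 * suc j)
    rearrange = solve-∀

  Antipode : Fin n × Fin n → Fin n × Fin n
  Antipode (a , b) = antipode a , antipode b

  antipode-involutive : ∀ a → antipode (antipode a) ≡ a
  antipode-involutive a = begin
    md (toℕ (md (toℕ a + k)) + k) ≡⟨ md-toℕ-md (toℕ a + k) k ⟩
    md (toℕ a + k + k)            ≡⟨ md-cong 0 1 (twice (toℕ a) k') ⟩
    md (toℕ a)                    ≡⟨ md-toℕ a ⟩
    a                             ∎
    where
    open ≡-Reasoning
    twice : ∀ a j → a + suc j + suc j + 0 * (2 * suc j) ≡ a + 1 * (2 * suc j)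
    twice = solve-∀

  Antipode-involutive : ∀ u → Antipode (Antipode u) ≡ u
  Antipode-involutive (a , b) = cong₂ _,_ (antipode-involutive a) (antipode-involutive b)

  toℕ-antipode<k : ∀ {a} → k ≤ toℕ a → toℕ (antipode a) < k
  toℕ-antipode<k {a} k≤a = subst (_< k) (sym (toℕ-md-+k k≤a (toℕ<n a))) (∸k<k (toℕ<n a))

  torusDist-Antipode : ∀ u v → torusDist (Antipode u) (Antipode v) ≡ torusDist u v
  torusDist-Antipode (a , b) (a' , b') = cong₂ _+_ (cycDist-antipode a a') (cycDist-antipode b b')

  torusDist-Antipodeˡ : ∀ u v → torusDist (Antipode u) v + torusDist u v ≡ n
  torusDist-Antipodeˡ (a , b) (a' , b') =
    trans (+-interchange (cycDist (antipode a) a') (cycDist (antipode b) b') (cycDist a a') (cycDist b b'))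
    (trans (cong₂ _+_ (cycDist-antipodeˡ a a') (cycDist-antipodeˡ b b')) (sym n≡k+k))

  torusDist-Antipodeʳ : ∀ u v → torusDist u (Antipode v) + torusDist u v ≡ n
  torusDist-Antipodeʳ (a , b) (a' , b') =
    trans (+-interchange (cycDist a (antipode a')) (cycDist b (antipode b')) (cycDist a a') (cycDist b b'))
    (trans (cong₂ _+_ (cycDist-antipodeʳ a a') (cycDist-antipodeʳ b b')) (sym n≡k+k))

  torusDist≤n : ∀ u v → torusDist u v ≤ n
  torusDist≤n u v = subst (torusDist u v ≤_) (sym n≡k+k)
    (+-mono-≤ (minArc≤k (offset (proj₁ u) (proj₁ v))) (minArc≤k (offset (proj₂ u) (proj₂ v))))

  Diam≤n : ∀ {D} → Diam (TorusAdj n) D → D ≤ n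
  Diam≤n = Diam≤ torusDist torus-walk torusDist≤n

  data Slot : Set where
    slot : ℕ → ℕ → Fin 2 → Slot

  Valid : Slot → Set
  Valid (slot x r t) = x < k × r < k

  rank : Slot → ℕ
  rank (slot x r t) = toℕ t + r * 2 + x * n

  -- Within a column x the base vertices alternate between the rows r and r + k, so consecutive
  -- ones differ by (0, k) or (0, 1 − k), and by (1, 1 − k) when the column changes.
  base : Slot → Fin n × Fin n
  base (slot x r t) = md x , md ((x + toℕ t) * k + r)

  vertex : Slot → Fin 2 → Fin n × Fin n
  vertex p zero       = base p
  vertex p (suc zero) = Antipode (base p)

  label : Slot → Fin 2 → ℕ
  label p e = suc (toℕ e + (k + 2) * rank p)

  n≡k*2 : n ≡ k * 2
  n≡k*2 = *-comm 2 k

  digit<n : ∀ {r} (t : Fin 2) → r < k → toℕ t + r * 2 < n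
  digit<n {r} t (s≤s r≤k') = begin-strict
    toℕ t + r * 2    <⟨ s≤s (+-mono-≤ (<⇒≤pred (toℕ<n t)) (*-monoˡ-≤ 2 r≤k')) ⟩
    suc (1 + k' * 2) ≡⟨ n≡k*2 ⟨
    n                ∎
    where open ≤-Reasoning

  rank-injective : ∀ {p p'} → Valid p → Valid p' → rank p ≡ rank p' → p ≡ p'
  rank-injective {slot x r t} {slot x' r' t'} (_ , r<k) (_ , r'<k) eq
    with divMod-injective x x' (digit<n t r<k) (digit<n t' r'<k) eq
  ... | digits≡ , refl with divMod-injective r r' (toℕ<n t) (toℕ<n t') digits≡
  ... | t≡t' , refl rewrite toℕ-injective t≡t' = refl

  data _⋖_ : Slot → Slot → Set where
    half-step : ∀ {x r} → slot x r zero ⋖ slot x r (suc zero)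
    row-step  : ∀ {x r} → slot x r (suc zero) ⋖ slot x (suc r) zero
    col-step  : ∀ {x}   → slot x k' (suc zero) ⋖ slot (suc x) 0 zero

  within-column : ∀ {x r r'} t t' → toℕ t' + r' * 2 ≡ suc (toℕ t + r * 2) → slot x r t ⋖ slot x r' t'
  within-column {r = r} {r'} zero zero eq with () ← proj₁ (divMod-injective r' r z<s (s≤s z<s) eq)
  within-column {r = r} {r'} zero (suc zero) eq
    with refl ← proj₂ (divMod-injective r' r (s≤s z<s) (s≤s z<s) eq) = half-step
  within-column {r = r} {r'} (suc zero) zero eq with refl ← proj₂ (divMod-injective r' (suc r) z<s z<s eq) = row-step
  within-column {r = r} {r'} (suc zero) (suc zero) eq with () ← proj₁ (divMod-injective r' (suc r) (s≤s z<s) z<s eq)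

  across-columns : ∀ {x r r'} t t' → suc (toℕ t + r * 2) ≡ n → toℕ t' + r' * 2 ≡ 0 →
                   slot x r t ⋖ slot (suc x) r' t'
  across-columns {r = r} zero _ last _ with () ← proj₁ (divMod-injective r k (s≤s z<s) z<s (trans last n≡k*2))
  across-columns {r = r} {zero} (suc zero) zero last _
    with refl ← suc-injective (proj₂ (divMod-injective (suc r) k z<s z<s (trans last n≡k*2))) = col-step

  rank-suc⇒⋖ : ∀ {p p'} → Valid p → Valid p' → rank p' ≡ suc (rank p) → p ⋖ p'
  rank-suc⇒⋖ {slot x r t} {slot x' r' t'} (_ , r<k) (_ , r'<k) eq with m≤n⇒m<n∨m≡n (digit<n t r<k)
  ... | inj₁ 1+digits<n with divMod-injective x' x (digit<n t' r'<k) 1+digits<n eq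
  ...   | digits≡ , refl = within-column t t' digits≡
  rank-suc⇒⋖ {slot x r t} {slot x' r' t'} (_ , r<k) (_ , r'<k) eq | inj₂ 1+digits≡n
    with divMod-injective x' (suc x) (digit<n t' r'<k) (<-trans z<s 1<n) (trans eq (cong (_+ x * n) 1+digits≡n))
  ... | digits≡0 , refl = across-columns t t' 1+digits≡n digits≡0

  k'<n : k' < n
  k'<n = m≤m+n k (k + 0)

  ⋖-torusDist : ∀ {p p'} → p ⋖ p' → k' ≤ torusDist (base p) (base p') × torusDist (base p) (base p') ≤ k
  ⋖-torusDist (half-step {x} {r}) = subst (λ L → k' ≤ L × L ≤ k) (sym L≡k) (n≤1+n k' , ≤-refl)
    where
    shift : ∀ x r j → (x + 1) * suc j + r + suc j ≡ (x + 0) * suc j + r + 1 * (2 * suc j)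
    shift = solve-∀
    L≡k : cycDist (md x) (md x) + cycDist (md ((x + 0) * k + r)) (md ((x + 1) * k + r)) ≡ k
    L≡k = cong₂ _+_ (cycDist-refl (md x)) (trans (cycDist-md 1 k<n (shift x r k')) (minArc-≤k ≤-refl))
  ⋖-torusDist (row-step {x} {r}) = subst (λ L → k' ≤ L × L ≤ k) (sym L≡k') (≤-refl , n≤1+n k')
    where
    shift : ∀ x r j → (x + 0) * suc j + suc r + j ≡ (x + 1) * suc j + r + 0 * (2 * suc j)
    shift = solve-∀
    L≡k' : cycDist (md x) (md x) + cycDist (md ((x + 1) * k + r)) (md ((x + 0) * k + suc r)) ≡ k'
    L≡k' = cong₂ _+_ (cycDist-refl (md x)) (trans (cycDist-md 0 k'<n (shift x r k')) (minArc-≤k (n≤1+n k')))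
  ⋖-torusDist (col-step {x}) = subst (λ L → k' ≤ L × L ≤ k) (sym L≡k) (n≤1+n k' , ≤-refl)
    where
    shiftX : ∀ x j → suc x + (j + suc j) ≡ x + 1 * (2 * suc j)
    shiftX = solve-∀
    shiftY : ∀ x j → (suc x + 0) * suc j + 0 + j ≡ (x + 1) * suc j + j + 0 * (2 * suc j)
    shiftY = solve-∀
    k'+k<n : k' + k < n
    k'+k<n = subst (k' + k <_) (sym n≡k+k) (+-monoˡ-< k (n<1+n k'))
    L≡k : cycDist (md x) (md (suc x)) + cycDist (md ((x + 1) * k + k')) (md ((suc x + 0) * k + 0)) ≡ k
    L≡k = cong₂ _+_
      (trans (cycDist-md 1 k'+k<n (shiftX x k')) (trans (minArc-+k (n≤1+n k')) (m+n∸n≡m 1 k')))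
      (trans (cycDist-md 0 k'<n (shiftY x k')) (minArc-≤k (n≤1+n k')))

  torusDist-antipodalˡ : ∀ u → torusDist (Antipode u) u ≡ n
  torusDist-antipodalˡ u = trans (sym (+-identityʳ (torusDist (Antipode u) u)))
    (trans (cong (torusDist (Antipode u) u +_) (sym (torusDist-refl u))) (torusDist-Antipodeˡ u u))

  torusDist-antipodalʳ : ∀ u → torusDist u (Antipode u) ≡ n
  torusDist-antipodalʳ u = trans (sym (+-identityʳ (torusDist u (Antipode u))))
    (trans (cong (torusDist u (Antipode u) +_) (sym (torusDist-refl u))) (torusDist-Antipodeʳ u u))

  label-zero≤ : ∀ p e → label p zero ≤ label p e
  label-zero≤ p e = s≤s (+-monoˡ-≤ ((k + 2) * rank p) (z≤n {toℕ e}))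

  label≤one : ∀ p e → label p e ≤ label p (suc zero)
  label≤one p e = s≤s (+-monoˡ-≤ ((k + 2) * rank p) (<⇒≤pred (toℕ<n e)))

  label-same-side : ∀ {p p'} e → rank p' ≡ suc (rank p) → label p e + (k + 2) ≡ label p' e
  label-same-side {p} e eq rewrite eq = shift (toℕ e) k (rank p)
    where
    shift : ∀ e K P → suc (e + (K + 2) * P) + (K + 2) ≡ suc (e + (K + 2) * suc P)
    shift = solve-∀

  label-step : ∀ {p p'} e e' → rank p' ≡ suc (rank p) → label p e + suc k ≤ label p' e'
  label-step {p} {p'} e e' eq = begin
    label p e + suc k           ≤⟨ +-monoˡ-≤ (suc k) (label≤one p e) ⟩
    label p (suc zero) + suc k  ≡⟨ shift k (rank p) ⟩
    suc ((k + 2) * suc (rank p)) ≡⟨ cong (λ P → suc ((k + 2) * P)) eq ⟨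
    label p' zero               ≤⟨ label-zero≤ p' e' ⟩
    label p' e'                 ∎
    where
    open ≤-Reasoning
    shift : ∀ K P → suc (1 + (K + 2) * P) + suc K ≡ suc ((K + 2) * suc P)
    shift = solve-∀

  label-far : ∀ {p p'} e e' → 2 + rank p ≤ rank p' → label p e + suc n ≤ label p' e'
  label-far {p} {p'} e e' far = begin
    label p e + suc n                  ≤⟨ +-monoˡ-≤ (suc n) (label≤one p e) ⟩
    label p (suc zero) + suc n         ≤⟨ m≤m+n _ 2 ⟩
    label p (suc zero) + suc n + 2     ≡⟨ shift k (rank p) ⟩
    suc ((k + 2) * (2 + rank p))       ≤⟨ s≤s (*-monoʳ-≤ (k + 2) far) ⟩
    label p' zero                      ≤⟨ label-zero≤ p' e' ⟩
    label p' e'                        ∎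
    where
    open ≤-Reasoning
    shift : ∀ K P → suc (1 + (K + 2) * P) + suc (2 * K) + 2 ≡ suc ((K + 2) * (2 + P))
    shift = solve-∀

  radio-by-gap : ∀ {T g} a b → suc n ≤ T + g → a + g ≤ b → suc n ≤ T + ∣ a - b ∣
  radio-by-gap {T} {g} a b total gap = ≤-trans total (+-monoʳ-≤ T g≤∣a-b∣)
    where
    g≤∣a-b∣ : g ≤ ∣ a - b ∣
    g≤∣a-b∣ = subst (g ≤_) (sym (m≤n⇒∣m-n∣≡n∸m (≤-trans (m≤m+n a g) gap)))
                (m+n≤o⇒m≤o∸n g (subst (_≤ b) (+-comm a g) gap))

  complement-bound : ∀ {T L} → T + L ≡ n → L ≤ k → suc n ≤ T + suc k
  complement-bound {T} {L} T+L≡n L≤k = begin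
    suc n       ≡⟨ cong suc T+L≡n ⟨
    suc (T + L) ≤⟨ s≤s (+-monoʳ-≤ T L≤k) ⟩
    suc (T + k) ≡⟨ +-suc T k ⟨
    T + suc k   ∎
    where open ≤-Reasoning

  antipodal-bound : ∀ {T} → T ≡ n → suc n ≤ T + 1
  antipodal-bound refl = ≤-reflexive (+-comm 1 n)

  same-side-bound : ∀ {T} → k' ≤ T → suc n ≤ T + (k + 2)
  same-side-bound {T} k'≤T = ≤-trans (≤-reflexive (total k')) (+-monoˡ-≤ (k + 2) k'≤T)
    where
    total : ∀ j → suc (2 * suc j) ≡ j + (suc j + 2)
    total = solve-∀

  Radio : Slot → Fin 2 → Slot → Fin 2 → Set
  Radio p e p' e' = suc n ≤ torusDist (vertex p e) (vertex p' e') + ∣ label p e - label p' e' ∣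

  same-slot : ∀ p e e' → vertex p e ≢ vertex p e' → Radio p e p e'
  same-slot p zero       zero       ne = ⊥-elim (ne refl)
  same-slot p (suc zero) (suc zero) ne = ⊥-elim (ne refl)
  same-slot p zero       (suc zero) _  =
    radio-by-gap (label p zero) (label p (suc zero))
      (antipodal-bound (torusDist-antipodalʳ (base p))) (≤-reflexive (+-comm _ 1))
  same-slot p (suc zero) zero       _  = subst (λ g → suc n ≤ torusDist (Antipode (base p)) (base p) + g)
    (∣-∣-comm (label p zero) (label p (suc zero)))
    (radio-by-gap (label p zero) (label p (suc zero))
      (antipodal-bound (torusDist-antipodalˡ (base p))) (≤-reflexive (+-comm _ 1)))

  consecutive : ∀ {p p'} e e' → p ⋖ p' → rank p' ≡ suc (rank p) → Radio p e p' e'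
  consecutive {p} {p'} e e' cover rank-suc with ⋖-torusDist cover
  ... | k'≤L , L≤k with e | e'
  ...   | zero     | zero     = radio-by-gap (label p zero) (label p' zero)
    (same-side-bound k'≤L)
    (≤-reflexive (label-same-side {p} {p'} zero rank-suc))
  ...   | suc zero | suc zero = radio-by-gap (label p (suc zero)) (label p' (suc zero))
    (same-side-bound (≤-trans k'≤L (≤-reflexive (sym (torusDist-Antipode (base p) (base p'))))))
    (≤-reflexive (label-same-side {p} {p'} (suc zero) rank-suc))
  ...   | zero     | suc zero = radio-by-gap (label p zero) (label p' (suc zero))
    (complement-bound {T = torusDist (base p) (Antipode (base p'))}
                      (torusDist-Antipodeʳ (base p) (base p')) L≤k)
    (label-step {p} {p'} zero (suc zero) rank-suc)
  ...   | suc zero | zero     = radio-by-gap (label p (suc zero)) (label p' zero)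
    (complement-bound {T = torusDist (Antipode (base p)) (base p')}
                      (torusDist-Antipodeˡ (base p) (base p')) L≤k)
    (label-step {p} {p'} (suc zero) zero rank-suc)

  radio-pair : ∀ {p p'} e e' → Valid p → Valid p' → vertex p e ≢ vertex p' e' → rank p ≤ rank p' →
               Radio p e p' e'
  radio-pair {p} {p'} e e' vp vp' ne le with m≤n⇒m<n∨m≡n le
  ... | inj₂ same rewrite rank-injective vp vp' same = same-slot p' e e' ne
  ... | inj₁ lt with m≤n⇒m<n∨m≡n lt
  ...   | inj₂ 1+P≡P' = consecutive e e' (rank-suc⇒⋖ vp vp' (sym 1+P≡P')) (sym 1+P≡P')
  ...   | inj₁ far  = radio-by-gap (label p e) (label p' e') (m≤n+m (suc n) _) (label-far {p} {p'} e e' far)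

  split-halves : ∀ {w} → w < n → ∃₂ λ (t : Fin 2) r → r < k × toℕ t * k + r ≡ w
  split-halves {w} w<n with w <? k
  ... | yes w<k = zero , w , w<k , refl
  ... | no  w≮k = suc zero , w ∸ k , ∸k<k w<n ,
                  trans (cong (_+ (w ∸ k)) (+-identityʳ k)) (m+[n∸m]≡n (≮⇒≥ w≮k))

  -- Since 2xk ≡ 0 (mod n), adding xk to the second coordinate undoes the shift by xk.
  base-surjective : ∀ u → toℕ (proj₁ u) < k → ∃ λ p → Valid p × base p ≡ u
  base-surjective (X , Y) x<k with split-halves (toℕ<n (md (toℕ Y + toℕ X * k)))
  ... | t , r , r<k , tk+r≡w = slot (toℕ X) r t , (x<k , r<k) , cong₂ _,_ (md-toℕ X) (begin
    md ((x + toℕ t) * k + r)              ≡⟨ cong md (distrib x (toℕ t) k r) ⟩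
    md (x * k + (toℕ t * k + r))          ≡⟨ cong (λ w → md (x * k + w)) tk+r≡w ⟩
    md (x * k + toℕ (md (toℕ Y + x * k))) ≡⟨ md-toℕ-mdʳ (x * k) (toℕ Y + x * k) ⟩
    md (x * k + (toℕ Y + x * k))          ≡⟨ md-cong 0 x (twice x (toℕ Y) k') ⟩
    md (toℕ Y)                            ≡⟨ md-toℕ Y ⟩
    Y                                     ∎)
    where
    open ≡-Reasoning
    x = toℕ X
    distrib : ∀ x t k r → (x + t) * k + r ≡ x * k + (t * k + r)
    distrib = solve-∀
    twice : ∀ x y j → x * suc j + (y + x * suc j) + 0 * (2 * suc j) ≡ y + x * (2 * suc j)
    twice = solve-∀

  Decomposition : Fin n × Fin n → Set
  Decomposition u = ∃₂ λ p e → Valid p × vertex p e ≡ u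

  decompose : ∀ u → Decomposition u
  decompose u with toℕ (proj₁ u) <? k
  ... | yes x<k = let p , vp , eq = base-surjective u x<k in p , zero , vp , eq
  ... | no  x≮k = let p , vp , eq = base-surjective (Antipode u) (toℕ-antipode<k (≮⇒≥ x≮k))
                  in p , suc zero , vp , trans (cong Antipode eq) (Antipode-involutive u)

  maxRank : ℕ
  maxRank = 1 + k' * 2 + k' * n

  rank≤maxRank : ∀ {p} → Valid p → rank p ≤ maxRank
  rank≤maxRank {slot x r t} (s≤s x≤k' , s≤s r≤k') =
    +-mono-≤ (+-mono-≤ (<⇒≤pred (toℕ<n t)) (*-monoˡ-≤ 2 r≤k')) (*-monoˡ-≤ n x≤k')

  half-square : (n * n ∸ 2) / 2 ≡ maxRank
  half-square = begin
    (n * n ∸ 2) / 2             ≡⟨ cong (λ m → (m ∸ 2) / 2) (square k') ⟩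
    (2 + maxRank * 2 ∸ 2) / 2   ≡⟨ cong (_/ 2) (m+n∸m≡n 2 (maxRank * 2)) ⟩
    maxRank * 2 / 2             ≡⟨ m*n/n≡m maxRank 2 ⟩
    maxRank                     ∎
    where
    open ≡-Reasoning
    square : ∀ j → 2 * suc j * (2 * suc j) ≡ 2 + (1 + j * 2 + j * (2 * suc j)) * 2
    square = solve-∀

  label≤span : ∀ {p} e → Valid p → label p e ≤ ((n * n ∸ 2) / 2) * (k + 2) + 2
  label≤span {p} e vp = begin
    label p e                   ≤⟨ label≤one p e ⟩
    suc (1 + (k + 2) * rank p)  ≤⟨ s≤s (+-monoʳ-≤ 1 (*-monoʳ-≤ (k + 2) (rank≤maxRank vp))) ⟩
    suc (1 + (k + 2) * maxRank) ≡⟨ rearrange k maxRank ⟩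
    maxRank * (k + 2) + 2       ≡⟨ cong (λ m → m * (k + 2) + 2) half-square ⟨
    ((n * n ∸ 2) / 2) * (k + 2) + 2 ∎
    where
    open ≤-Reasoning
    rearrange : ∀ K M → suc (1 + (K + 2) * M) ≡ M * (K + 2) + 2
    rearrange = solve-∀

  labelOf : ∀ {u} → Decomposition u → ℕ
  labelOf (p , e , _) = label p e

  radio-walk : ∀ {u v m} (du : Decomposition u) (dv : Decomposition v) → u ≢ v → Walk (TorusAdj n) u v m →
               suc n ≤ m + ∣ labelOf du - labelOf dv ∣
  radio-walk (p , e , vp , refl) (p' , e' , vp' , refl) ne w with ≤-total (rank p) (rank p')
  ... | inj₁ le = ≤-trans (radio-pair e e' vp vp' ne le) (+-monoˡ-≤ _ (torusDist-≤-length w))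
  ... | inj₂ ge = ≤-trans (radio-pair e' e vp' vp (ne ∘ sym) ge)
                    (+-mono-≤ (torusDist-≤-length (reverse TorusAdj-sym w))
                              (≤-reflexive (∣-∣-comm (label p' e') (label p e))))

theorem3p3 : (k : ℕ) → 1 ≤ k → (n : ℕ) → n ≡ 2 * k →
    rn≤ (TorusAdj n) (((n * n ∸ 2) / 2) * (k + 2) + 2)
theorem3p3 (suc k') _ .(2 * suc k') refl = labelOf ∘ decompose , ((λ _ → s≤s z≤n) , radio) , span
  where
  open EvenTorus k'
  radio : ∀ D → Diam (TorusAdj n) D → ∀ u v → u ≢ v → ∀ d → Dist (TorusAdj n) u v d →
          suc D ≤ d + ∣ labelOf (decompose u) - labelOf (decompose v) ∣
  radio D diam u v u≢v d (w , _) = ≤-trans (s≤s (Diam≤n diam)) (radio-walk (decompose u) (decompose v) u≢v w)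
  span : ∀ u → labelOf (decompose u) ≤ ((n * n ∸ 2) / 2) * (k + 2) + 2
  span u = let _ , e , vp , _ = decompose u in label≤span e vp
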